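{- Let $G=(V,E,\mathcal{P},s,t,c)$ be an update flow network whose underlying directed graph $(V,E)$ is acyclic, and suppose $\sigma$ is a valid update sequence for $G$. Then there exists a valid update sequence $\sigma'$ for $G$ which updates every block in consecutive rounds, i.e., for every block $b$ of every pair $P_i$, the updates $(v,P_i)$ with $v\in V(b)\setminus\{\mathrm{End}(b)\}$ occupy consecutive positions of $\sigma'$.
   Context: A flow network is $G=(V,E,s,t,c)$: a directed graph $(V,E)$ with source $s$, terminal $t$ and capacities $c\colon E\to\mathbb{N}$. An $(s,t)$-flow of demand $d$ is a directed $s$–$t$ path with $d\le c(e)$ on its edges; a family of flows with demands $d_i$ is valid if $c(e)\ge\sum_{i:\,e\in E(F_i)}d_i$ for every edge $e$. An update flow pair $P=(F^o,F^u)$ consists of an old and an update $(s,t)$-flow of the same demand. An update flow network $G=(V,E,\mathcal{P},s,t,c)$ has pairs $\mathcal{P}=\{P_1,\dots,P_k\}$, $P_i=(F^o_i,F^u_i)$ of demand $d_i$, with $V,E$ the unions of the vertices/edges of all these flows, and both the family of old flows and the family of update flows valid. An update is $(v,P)\in V\times\mathcal{P}$; resolving it deactivates the outgoing edges of $F^o$ at $v$ and activates the outgoing edges of $F^u$ at $v$ (edges in both stay active). Initially exactly the old-flow edges are active. $G(P,U)$ is the graph on $V(F^o)\cup V(F^u)$ of edges of $P$ active after resolving the updates in $U$; $P$ is transient for $U$ if $G(P,U)$ contains a unique $(s,t)$-path $T_{P,U}$. An update sequence is an ordering $\sigma$ of $V\times\mathcal{P}$, with $U_i$ its first $i$ updates;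 it is valid if for every $i$ every pair is transient for $U_i$ and the transient flows $\{T_{P,U_i}\}$ (with their demands) respect all capacities. Blocks: fix a topological order $\prec$ of the acyclic graph $(V,E)$. For a pair $P_i$, let $z^i_1\prec\dots\prec z^i_{k_i}$ be the vertices of $V(F^o_i)\cap V(F^u_i)$. For $j\in[k_i-1]$, the $j$-th block $b^i_j$ of $P_i$ is the subgraph of $F^o_i\cup F^u_i$ induced by $\{v\in V(F^o_i\cup F^u_i): z^i_j\preceq v\preceq z^i_{j+1}\}$; $\mathrm{Start}(b)=z^i_j$ and $\mathrm{End}(b)=z^i_{j+1}$ are its $\prec$-smallest and $\prec$-largest vertices. -}

module Defs where

open import Data.Nat using (ℕ; zero; suc; _≤_; _<_)
open import Data.Fin using (Fin)
import Data.Fin as F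
open import Data.Fin.Properties using () renaming (_≟_ to _≟ᶠ_)
open import Data.Nat.ListAction using (sum)
open import Data.List using (List; []; _∷_; map; allFin; length; lookup; take)
open import Data.List.Membership.Propositional using (_∈_; _∉_)
open import Data.List.Relation.Unary.Unique.Propositional using (Unique)
open import Data.Product using (_×_; _,_; ∃; ∃-syntax; Σ)
open import Data.Product.Properties using (≡-dec)
open import Data.Sum using (_⊎_)
open import Data.Bool using (if_then_else_)
open import Relation.Nullary using (¬_; does)
import Relation.Nullary
import Data.Empty
open import Relation.Binary.PropositionalEquality using (_≡_)
open import Relation.Binary.Construct.Closure.Transitive using (TransClosure)
open import Function using (Injective)
import Data.List.Membership.DecPropositional as DecMem

-- Vertices are Fin n.  A path / flow is given by its list of vertices.

data Walk {n : ℕ} (R : Fin n → Fin n → Set) : Fin n → Fin n → List (Fin n) → Set where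
  here : ∀ {v} → Walk R v v (v ∷ [])
  step : ∀ {u w v vs} → R u w → Walk R w v (w ∷ vs) → Walk R u v (u ∷ w ∷ vs)

IsPath : {n : ℕ} → (Fin n → Fin n → Set) → Fin n → Fin n → List (Fin n) → Set
IsPath R u v p = Walk R u v p × Unique p

edges : {n : ℕ} → List (Fin n) → List (Fin n × Fin n)
edges []            = []
edges (u ∷ [])      = []
edges (u ∷ w ∷ vs)  = (u , w) ∷ edges (w ∷ vs)

_≟ₑ_ : {n : ℕ} → (e f : Fin n × Fin n) → Relation.Nullary.Dec (e ≡ f)
_≟ₑ_ = ≡-dec _≟ᶠ_ _≟ᶠ_

_∈ₑ?_ : {n : ℕ} → (e : Fin n × Fin n) → (es : List (Fin n × Fin n)) → Relation.Nullary.Dec (e ∈ es)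
_∈ₑ?_ {n} = DecMem._∈?_ (_≟ₑ_ {n})

record UFN (n k : ℕ) : Set where
  field
    s   : Fin n
    t   : Fin n
    cap : Fin n → Fin n → ℕ        -- capacity (only relevant on E)
    dem : Fin k → ℕ
    old : Fin k → List (Fin n)
    upd : Fin k → List (Fin n)

module _ {n k : ℕ} (G : UFN n k) where
  open UFN G

  IsFlow : ℕ → List (Fin n) → Set
  IsFlow d p = IsPath (λ u w → d ≤ cap u w) s t p

  load : (Fin k → List (Fin n)) → Fin n → Fin n → ℕ
  load T u w = sum (map (λ i → if does ((u , w) ∈ₑ? edges (T i)) then dem i else 0) (allFin k))

  ValidFamily : (Fin k → List (Fin n)) → Set
  ValidFamily T = ∀ u w → load T u w ≤ cap u w

  VertexOf : Fin k → Fin n → Set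
  VertexOf i v = v ∈ old i ⊎ v ∈ upd i

  CommonVertex : Fin k → Fin n → Set
  CommonVertex i v = v ∈ old i × v ∈ upd i

  Edge : Fin n → Fin n → Set
  Edge u w = ∃[ i ] ((u , w) ∈ edges (old i) ⊎ (u , w) ∈ edges (upd i))

  -- G is an update flow network; V = Fin n is the union of the flow vertices
  IsUpdateFlowNetwork : Set
  IsUpdateFlowNetwork =
      (∀ i → IsFlow (dem i) (old i))
    × (∀ i → IsFlow (dem i) (upd i))
    × ValidFamily old
    × ValidFamily upd
    × (∀ v → ∃[ i ] VertexOf i v)

  Acyclic : Set
  Acyclic = ∀ v → ¬ TransClosure Edge v v

  IsTopOrder : (Fin n → ℕ) → Set
  IsTopOrder rank = Injective _≡_ _≡_ rank × (∀ u w → Edge u w → rank u < rank w)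

  Update : Set
  Update = Fin n × Fin k

  Active : List Update → Fin k → Fin n → Fin n → Set
  Active U i u w =
      ((u , w) ∈ edges (old i) × (u , i) ∉ U)
    ⊎ ((u , w) ∈ edges (upd i) × (u , i) ∈ U)

  GoodState : List Update → Set
  GoodState U =
    Σ (Fin k → List (Fin n)) λ T →
        (∀ i → IsPath (Active U i) s t (T i))
      × (∀ i p → IsPath (Active U i) s t p → p ≡ T i)
      × ValidFamily T

  IsUpdateSequence : List Update → Set
  IsUpdateSequence σ = Unique σ × (∀ x → x ∈ σ)

  ValidUpdateSequence : List Update → Set
  ValidUpdateSequence σ = IsUpdateSequence σ × (∀ j → GoodState (take j σ))

  -- z, z' are consecutive (w.r.t. ≺) common vertices of P_i, i.e.
  -- z = z^i_j and z' = z^i_{j+1}; they determine the block b with Start z, End z'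
  IsBlock : (Fin n → ℕ) → Fin k → Fin n → Fin n → Set
  IsBlock rank i z z' =
      CommonVertex i z × CommonVertex i z' × rank z < rank z'
    × (∀ w → CommonVertex i w → rank z < rank w → rank w < rank z' → Data.Empty.⊥)

  BlockUpdate : (Fin n → ℕ) → Fin k → Fin n → Fin n → Update → Set
  BlockUpdate rank i z z' (v , i') =
    i' ≡ i × VertexOf i v × rank z ≤ rank v × rank v < rank z'

Consecutive : {A : Set} → (A → Set) → List A → Set
Consecutive S σ = ∀ (a b c : Fin (length σ)) → a F.< b → b F.< c →
  S (lookup σ a) → S (lookup σ c) → S (lookup σ b)

-- Regroup σ: each update (v , P) at a common vertex v of P (or at a vertex not on P) is replaced
-- by the updates of the whole block starting at v, and the remaining updates are dropped from
-- their original positions.  Only the updates at common vertices change which flow is followed: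
-- an inner vertex of a block lying on one flow only is unreachable from s unless that flow is the
-- one selected at the block start, and in a valid state the transient path then forces it to be
-- resolved accordingly.  So every prefix of the regrouped sequence has, on the part of G(P , U)
-- reachable from s, the same active edges as some prefix of σ, hence the same transient flows.

module Submission where

open import Data.Nat using (ℕ; zero; suc; _≤_; _<_; _<?_; s≤s)
open import Data.Nat.Properties
  using (≤-refl; <⇒≤; <⇒≱; <-irrefl; ≤-<-trans; <-≤-trans; <-trans; ≤-antisym; ≮⇒≥; <-cmp; ≤∧≢⇒<; m≤n⇒m<n∨m≡n)
open import Data.Fin using (Fin)
import Data.Fin as F
open import Data.Fin.Properties using (all?) renaming (_≟_ to _≟ᶠ_)
open import Data.List using (List; []; _∷_; _++_; [_]; length; lookup; map; filter; allFin; take; concatMap)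
open import Data.List.Properties using (++-assoc; ++-identityʳ; take-all; concatMap-++)
open import Data.List.Extrema.Nat using (argmax; argmax-all; f[xs]≤f[argmax])
open import Data.List.Membership.Propositional using (_∈_; _∉_)
open import Data.List.Membership.Propositional.Properties
  using (∈-lookup; ∈-filter⁺; ∈-filter⁻; ∈-allFin; ∈-map⁺; ∈-map⁻; ∈-++⁺ˡ; ∈-++⁺ʳ; ∈-++⁻; ∈-∃++)
import Data.List.Membership.DecPropositional as DecMembership
open import Data.List.Relation.Binary.Subset.Propositional using (_⊆_)
open import Data.List.Relation.Unary.Any using (here; there)
open import Data.List.Relation.Unary.Any.Properties using (¬Any[])
open import Data.List.Relation.Unary.All as All using (All; []; _∷_)
open import Data.List.Relation.Unary.All.Properties using (all-filter)
open import Data.List.Relation.Unary.AllPairs using ([]; _∷_)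
open import Data.List.Relation.Unary.Unique.Propositional using (Unique)
import Data.List.Relation.Unary.Unique.Propositional.Properties as Unique
open import Data.Product using (Σ; _×_; _,_; proj₁; proj₂)
open import Data.Product.Properties using (≡-dec)
open import Data.Sum using (_⊎_; inj₁; inj₂)
open import Data.Empty using (⊥-elim)
open import Function using (id; _∘_; _⇔_; Equivalence; mk⇔)
open import Relation.Binary using (tri<; tri≈; tri>)
open import Relation.Nullary using (¬_; Dec; yes; no)
open import Relation.Nullary.Decidable using (_×-dec_; _⊎-dec_; _→-dec_; ¬?; map′)
open import Relation.Binary.PropositionalEquality using (_≡_; refl; sym; trans; cong; subst; subst₂)

open import Defs

module _ {A : Set} where

  ∈-take⁻ : ∀ {y : A} r xs → y ∈ take r xs → y ∈ xs
  ∈-take⁻ (suc r) (x ∷ xs) (here y≡x) = here y≡x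
  ∈-take⁻ (suc r) (x ∷ xs) (there y∈) = there (∈-take⁻ r xs y∈)

  take-[] : ∀ j → take j ([] {A = A}) ≡ []
  take-[] zero    = refl
  take-[] (suc j) = refl

  take-++-split : ∀ j (X Y : List A) → take j (X ++ Y) ≡ take j X ⊎ Σ ℕ λ m → take j (X ++ Y) ≡ X ++ take m Y
  take-++-split j       []      Y = inj₂ (j , refl)
  take-++-split zero    (x ∷ X) Y = inj₁ refl
  take-++-split (suc j) (x ∷ X) Y with take-++-split j X Y
  ... | inj₁ e       = inj₁ (cong (x ∷_) e)
  ... | inj₂ (m , e) = inj₂ (m , cong (x ∷_) e)

module _ {A B : Set} where

  take-concatMap : ∀ (f : A → List B) xs j →
      take j (concatMap f xs) ≡ concatMap f xs
    ⊎ Σ (List A) λ D → Σ A λ x → Σ (List A) λ L → Σ ℕ λ r →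
        xs ≡ D ++ x ∷ L × take j (concatMap f xs) ≡ concatMap f D ++ take r (f x)
  take-concatMap f []       j = inj₁ (take-[] j)
  take-concatMap f (x ∷ xs) j with take-++-split j (f x) (concatMap f xs)
  ... | inj₁ e = inj₂ ([] , x , xs , j , refl , e)
  ... | inj₂ (m , e) with take-concatMap f xs m
  ...   | inj₁ e′ = inj₁ (trans e (cong (f x ++_) e′))
  ...   | inj₂ (D , y , L , r , refl , e′) =
    inj₂ (x ∷ D , y , L , r , refl , trans e (trans (cong (f x ++_) e′) (sym (++-assoc (f x) _ _))))

module _ {A : Set} where

  take-length-++ : ∀ (xs : List A) {ys} → take (length xs) (xs ++ ys) ≡ xs
  take-length-++ []       = refl
  take-length-++ (x ∷ xs) = cong (x ∷_) (take-length-++ xs)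

  take-suc-length-++ : ∀ (xs : List A) {y ys} → take (suc (length xs)) (xs ++ y ∷ ys) ≡ xs ++ [ y ]
  take-suc-length-++ []       = refl
  take-suc-length-++ (x ∷ xs) = cong (x ∷_) (take-suc-length-++ xs)

  take-before-pivot : ∀ {x y : A} r X Y →
    x ∉ take r (X ++ x ∷ Y) → y ∈ take r (X ++ x ∷ Y) → y ∈ X
  take-before-pivot (suc r) []      Y x∉ _           = ⊥-elim (x∉ (here refl))
  take-before-pivot (suc r) (a ∷ X) Y x∉ (here y≡a)  = here y≡a
  take-before-pivot (suc r) (a ∷ X) Y x∉ (there y∈) = there (take-before-pivot r X Y (x∉ ∘ there) y∈)

  take-past-pivot : ∀ {x y : A} r X Y →
    x ∉ X → x ∈ take r (X ++ x ∷ Y) → y ∈ X → y ∈ take r (X ++ x ∷ Y)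
  take-past-pivot (suc r) (a ∷ X) Y x∉X x∈         (here y≡a)  = here y≡a
  take-past-pivot (suc r) (a ∷ X) Y x∉X (here x≡a) (there y∈X) = ⊥-elim (x∉X (here x≡a))
  take-past-pivot (suc r) (a ∷ X) Y x∉X (there x∈) (there y∈X) =
    there (take-past-pivot r X Y (x∉X ∘ there) x∈ y∈X)

  Unique-pivot⁻ : ∀ {x : A} X {Y} → Unique (X ++ x ∷ Y) → x ∉ X × x ∉ Y
  Unique-pivot⁻ []      (x∉ ∷ _) = (λ ()) , λ x∈Y → All.lookup x∉ x∈Y refl
  Unique-pivot⁻ (a ∷ X) (a∉ ∷ uniq) =
      (λ { (here x≡a) → All.lookup a∉ (∈-++⁺ʳ X (here refl)) (sym x≡a) ; (there x∈X) → proj₁ rest x∈X })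
    , proj₂ rest
    where rest = Unique-pivot⁻ X uniq

  Consecutive-resp : ∀ {S S′ : A → Set} {σ} → (∀ {a} → S a ⇔ S′ a) → Consecutive S σ → Consecutive S′ σ
  Consecutive-resp S⇔S′ consec a b c a<b b<c S′a S′c =
    Equivalence.to S⇔S′ (consec a b c a<b b<c (Equivalence.from S⇔S′ S′a) (Equivalence.from S⇔S′ S′c))

  Consecutive-++ : ∀ {S : A → Set} X M Y →
    All (¬_ ∘ S) X → All S M → All (¬_ ∘ S) Y → Consecutive S (X ++ M ++ Y)
  Consecutive-++ []      M Y _         SM ¬SY _ b c _ b<c _ Sc = lookup-downClosed M Y SM ¬SY b c b<c Sc
    where
    lookup-downClosed : ∀ {S : A → Set} M Y → All S M → All (¬_ ∘ S) Y →
      ∀ (b c : Fin (length (M ++ Y))) → b F.< c → S (lookup (M ++ Y) c) → S (lookup (M ++ Y) b)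
    lookup-downClosed []      Y _         ¬SY b       c       _         Sc = ⊥-elim (All.lookup ¬SY (∈-lookup c) Sc)
    lookup-downClosed (m ∷ M) Y (Sm ∷ _)  ¬SY F.zero  c       _         _  = Sm
    lookup-downClosed (m ∷ M) Y (_ ∷ SM)  ¬SY (F.suc b) (F.suc c) (s≤s b<c) Sc =
      lookup-downClosed M Y SM ¬SY b c b<c Sc
  Consecutive-++ (x ∷ X) M Y (¬Sx ∷ _)  SM ¬SY F.zero b c _ _ Sa _ = ⊥-elim (¬Sx Sa)
  Consecutive-++ (x ∷ X) M Y (_ ∷ ¬SX)  SM ¬SY (F.suc a) (F.suc b) (F.suc c) (s≤s a<b) (s≤s b<c) Sa Sc =
    Consecutive-++ X M Y ¬SX SM ¬SY a b c a<b b<c Sa Sc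

module _ {n : ℕ} where

  private
    Rel : Set₁
    Rel = Fin n → Fin n → Set

  mapWalk : ∀ {R R′ : Rel} {a b p} →
    (∀ {u v} → (u , v) ∈ edges p → R′ u v) → Walk R a b p → Walk R′ a b p
  mapWalk f here       = here
  mapWalk f (step r w) = step (f (here refl)) (mapWalk (f ∘ there) w)

  source∈ : ∀ {R : Rel} {a b p} → Walk R a b p → a ∈ p
  source∈ here       = here refl
  source∈ (step _ _) = here refl

  target∈ : ∀ {R : Rel} {a b p} → Walk R a b p → b ∈ p
  target∈ here       = here refl
  target∈ (step _ w) = there (target∈ w)

  edge⇒R : ∀ {R : Rel} {a b p u v} → Walk R a b p → (u , v) ∈ edges p → R u v
  edge⇒R (step r _) (here refl) = r
  edge⇒R (step _ w) (there e)   = edge⇒R w e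

  ∈-edges⁻ : ∀ {p : List (Fin n)} {u v} → (u , v) ∈ edges p → u ∈ p × v ∈ p
  ∈-edges⁻ {_ ∷ _ ∷ _} (here refl) = here refl , there (here refl)
  ∈-edges⁻ {_ ∷ _ ∷ _} (there e)   = there (proj₁ (∈-edges⁻ e)) , there (proj₂ (∈-edges⁻ e))

  walk-suffix : ∀ {R : Rel} {a b p x} → Walk R a b p → x ∈ p →
    Σ (List (Fin n)) λ q → Walk R x b q × q ⊆ p
  walk-suffix here       (here refl) = _ , here , id
  walk-suffix (step r w) (here refl) = _ , step r w , id
  walk-suffix (step _ w) (there x∈)  with walk-suffix w x∈
  ... | q , wq , q⊆ = q , wq , there ∘ q⊆

  walk-leaves : ∀ {R : Rel} {a b p x} → Walk R a b p → x ∈ p → x ≡ b ⊎ Σ (Fin n) (R x)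
  walk-leaves here       (here refl) = inj₁ refl
  walk-leaves (step r _) (here refl) = inj₂ (_ , r)
  walk-leaves (step _ w) (there x∈)  = walk-leaves w x∈

  data Reachable (R : Rel) (s : Fin n) : Fin n → Set where
    source : Reachable R s s
    _▸_    : ∀ {u v} → Reachable R s u → R u v → Reachable R s v

  reachable-on-walk : ∀ {R : Rel} {s a b p y} → Reachable R s a → Walk R a b p → y ∈ p → Reachable R s y
  reachable-on-walk ra here       (here refl) = ra
  reachable-on-walk ra (step _ _) (here refl) = ra
  reachable-on-walk ra (step r w) (there y∈)  = reachable-on-walk (ra ▸ r) w y∈

  mapWalk-reachable : ∀ {R R′ : Rel} {s a b p} →
    (∀ {u v} → Reachable R s u → R u v → R′ u v) → Reachable R s a → Walk R a b p → Walk R′ a b p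
  mapWalk-reachable f ra here       = here
  mapWalk-reachable f ra (step r w) = step (f ra r) (mapWalk-reachable f (ra ▸ r) w)

module Ranked {n : ℕ} (rank : Fin n → ℕ) where

  _≺_ : Fin n → Fin n → Set
  u ≺ v = rank u < rank v

  source-least : ∀ {a b p x} → Walk _≺_ a b p → x ∈ p → rank a ≤ rank x
  source-least here       (here refl) = ≤-refl
  source-least (step _ _) (here refl) = ≤-refl
  source-least (step r w) (there x∈)  = <⇒≤ (<-≤-trans r (source-least w x∈))

  target-greatest : ∀ {a b p x} → Walk _≺_ a b p → x ∈ p → rank x ≤ rank b
  target-greatest here       (here refl) = ≤-refl
  target-greatest (step r w) (here refl) = <⇒≤ (<-≤-trans r (target-greatest w (source∈ w)))
  target-greatest (step _ w) (there x∈)  = target-greatest w x∈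

  edge-gap : ∀ {a b p x u v} → Walk _≺_ a b p → (u , v) ∈ edges p → x ∈ p →
    rank x ≤ rank u ⊎ rank v ≤ rank x
  edge-gap (step _ _) (here refl) (here refl) = inj₁ ≤-refl
  edge-gap (step _ w) (here refl) (there x∈)  = inj₂ (source-least w x∈)
  edge-gap (step r w) (there e)   (here refl) = inj₁ (<⇒≤ (<-≤-trans r (source-least w (proj₁ (∈-edges⁻ e)))))
  edge-gap (step _ w) (there e)   (there x∈)  = edge-gap w e x∈

  walk-hits : ∀ {R : Fin n → Fin n → Set} {a b q x} → (injective : ∀ {u v} → rank u ≡ rank v → u ≡ v) →
    (∀ {u v} → R u v → u ≺ v) → Walk R a b q → rank a ≤ rank x → rank x ≤ rank b →
    (∀ {u v} → u ∈ q → R u v → u ≺ x → rank v ≤ rank x) → x ∈ q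
  walk-hits inj asc here       a≤x x≤b _ = here (inj (≤-antisym x≤b a≤x))
  walk-hits inj asc (step r w) a≤x x≤b noJump with m≤n⇒m<n∨m≡n a≤x
  ... | inj₂ a≡x = here (inj (sym a≡x))
  ... | inj₁ a<x = there (walk-hits inj asc w (noJump (here refl) r a<x) x≤b (noJump ∘ there))

module Network {n k : ℕ} (G : UFN n k) (ufn : IsUpdateFlowNetwork G)
               (rank : Fin n → ℕ) (top : IsTopOrder G rank) where

  open UFN G
  open Ranked rank
  open DecMembership (_≟ᶠ_ {n}) using (_∈?_)
  open DecMembership (≡-dec (_≟ᶠ_ {n}) (_≟ᶠ_ {k})) using () renaming (_∈?_ to _∈ᵘ?_)

  Common Vertex : Fin k → Fin n → Set
  Common = CommonVertex G
  Vertex = VertexOf G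

  rank-injective : ∀ {u v} → rank u ≡ rank v → u ≡ v
  rank-injective = proj₁ top

  edge-ascends : ∀ {u v} → Edge G u v → u ≺ v
  edge-ascends = proj₂ top _ _

  old-ascending : ∀ i → Walk _≺_ s t (old i)
  old-ascending i = mapWalk (λ e → edge-ascends (i , inj₁ e)) (proj₁ (proj₁ ufn i))

  upd-ascending : ∀ i → Walk _≺_ s t (upd i)
  upd-ascending i = mapWalk (λ e → edge-ascends (i , inj₂ e)) (proj₁ (proj₁ (proj₂ ufn) i))

  Active-ascends : ∀ {U i u v} → Active G U i u v → u ≺ v
  Active-ascends (inj₁ (e , _)) = edge-ascends (_ , inj₁ e)
  Active-ascends (inj₂ (e , _)) = edge-ascends (_ , inj₂ e)

  Active-source : ∀ {U i u v} → Active G U i u v → Vertex i u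
  Active-source (inj₁ (e , _)) = inj₁ (proj₁ (∈-edges⁻ e))
  Active-source (inj₂ (e , _)) = inj₂ (proj₁ (∈-edges⁻ e))

  s-common : ∀ i → Common i s
  s-common i = source∈ (old-ascending i) , source∈ (upd-ascending i)

  t-common : ∀ i → Common i t
  t-common i = target∈ (old-ascending i) , target∈ (upd-ascending i)

  s-least : ∀ {i w} → Vertex i w → rank s ≤ rank w
  s-least (inj₁ w∈) = source-least (old-ascending _) w∈
  s-least (inj₂ w∈) = source-least (upd-ascending _) w∈

  t-greatest : ∀ {i w} → Vertex i w → rank w ≤ rank t
  t-greatest (inj₁ w∈) = target-greatest (old-ascending _) w∈
  t-greatest (inj₂ w∈) = target-greatest (upd-ascending _) w∈

  Active-gap : ∀ {U i u v c} → Common i c → Active G U i u v → rank c ≤ rank u ⊎ rank v ≤ rank c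
  Active-gap (c∈ , _) (inj₁ (e , _)) = edge-gap (old-ascending _) e c∈
  Active-gap (_ , c∈) (inj₂ (e , _)) = edge-gap (upd-ascending _) e c∈

  -- w ∈ V(b) ∖ {Start b , End b} for the block b of pair i with Start b = z
  record InBlock (i : Fin k) (z w : Fin n) : Set where
    field
      start-common : Common i z
      member       : Vertex i w
      after-start  : z ≺ w
      before-next  : ∀ c → Common i c → z ≺ c → w ≺ c

  open InBlock

  InBlock⇒¬Common : ∀ {i z w} → InBlock i z w → ¬ Common i w
  InBlock⇒¬Common zw cw = <-irrefl refl (before-next zw _ cw (after-start zw))

  InBlock-start-unique : ∀ {i z z′ w} → InBlock i z w → InBlock i z′ w → z ≡ z′
  InBlock-start-unique {z = z} {z′} zw z′w with <-cmp (rank z) (rank z′)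
  ... | tri< z≺z′ _ _ = ⊥-elim (<⇒≱ (after-start z′w) (<⇒≤ (before-next zw _ (start-common z′w) z≺z′)))
  ... | tri≈ _ z≡z′ _ = rank-injective z≡z′
  ... | tri> _ _ z′≺z = ⊥-elim (<⇒≱ (after-start zw) (<⇒≤ (before-next z′w _ (start-common zw) z′≺z)))

  InBlock-shrink : ∀ {i z w a} → InBlock i z w → Vertex i a → z ≺ a → a ≺ w → InBlock i z a
  InBlock-shrink zw va z≺a a≺w = record
    { start-common = start-common zw ; member = va ; after-start = z≺a
    ; before-next = λ c cc z≺c → <-trans a≺w (before-next zw c cc z≺c) }

  common? : ∀ i v → Dec (Common i v)
  common? i v = (v ∈? old i) ×-dec (v ∈? upd i)

  vertex? : ∀ i v → Dec (Vertex i v)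
  vertex? i v = (v ∈? old i) ⊎-dec (v ∈? upd i)

  inBlock? : ∀ i z w → Dec (InBlock i z w)
  inBlock? i z w = map′ (λ (cz , vw , z≺w , next) → record
                           { start-common = cz ; member = vw ; after-start = z≺w ; before-next = next })
                        (λ zw → start-common zw , member zw , after-start zw , before-next zw)
    (common? i z ×-dec vertex? i w ×-dec rank z <? rank w
       ×-dec all? (λ c → common? i c →-dec rank z <? rank c →-dec rank w <? rank c))

  -- the start of the block of w is the highest-ranked common vertex below w
  block-start : ∀ {i w} → Vertex i w → ¬ Common i w → Σ (Fin n) λ z → InBlock i z w
  block-start {i} {w} vw ¬cw = z , record
    { start-common = proj₁ z-below ; member = vw ; after-start = proj₂ z-below ; before-next = next }
    where
    below? : ∀ c → Dec (Common i c × c ≺ w)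
    below? c = common? i c ×-dec rank c <? rank w
    candidates : List (Fin n)
    candidates = filter below? (allFin n)
    z : Fin n
    z = argmax rank s candidates
    s≺w : s ≺ w
    s≺w = ≤∧≢⇒< (s-least vw) (λ s≡w → ¬cw (subst (Common i) (rank-injective s≡w) (s-common i)))
    z-below : Common i z × z ≺ w
    z-below = argmax-all rank (s-common i , s≺w) (all-filter below? (allFin n))
    next : ∀ c → Common i c → z ≺ c → w ≺ c
    next c cc z≺c with <-cmp (rank w) (rank c)
    ... | tri< w≺c _ _ = w≺c
    ... | tri≈ _ w≡c _ = ⊥-elim (¬cw (subst (Common i) (rank-injective (sym w≡c)) cc))
    ... | tri> _ _ c≺w = ⊥-elim (<⇒≱ z≺c
          (All.lookup (f[xs]≤f[argmax] s candidates) (∈-filter⁺ below? (∈-allFin c) (cc , c≺w))))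

  -- Traced backwards, a path reaching w uses update edges from inner vertices of z's block until
  -- it meets z itself, whose update edges are inactive while z is not updated.
  newInner-unreachable : ∀ {U i z w} → InBlock i z w → w ∈ upd i → (z , i) ∉ U →
    ¬ Reachable (Active G U i) s w
  newInner-unreachable {i = i} zw w∈ _ source = InBlock⇒¬Common zw (s-common i)
  newInner-unreachable zw w∈ _ (_ ▸ inj₁ (e , _)) = InBlock⇒¬Common zw (proj₂ (∈-edges⁻ e) , w∈)
  newInner-unreachable {U} {i} {z} zw w∈ z∉U (ra ▸ inj₂ (e , a∈U))
    with edge-gap (upd-ascending i) e (proj₂ (start-common zw))
  ... | inj₂ w≤z = <⇒≱ (after-start zw) w≤z
  ... | inj₁ z≤a with m≤n⇒m<n∨m≡n z≤a
  ...   | inj₂ z≡a = z∉U (subst (λ x → (x , i) ∈ U) (sym (rank-injective z≡a)) a∈U)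
  ...   | inj₁ z≺a = newInner-unreachable
          (InBlock-shrink zw (inj₂ a∈) z≺a (edge-ascends (i , inj₂ e))) a∈ z∉U ra
    where a∈ = proj₁ (∈-edges⁻ e)

  oldInner-unreachable : ∀ {U i z w} → InBlock i z w → w ∈ old i → (z , i) ∈ U →
    ¬ Reachable (Active G U i) s w
  oldInner-unreachable {i = i} zw w∈ _ source = InBlock⇒¬Common zw (s-common i)
  oldInner-unreachable zw w∈ _ (_ ▸ inj₂ (e , _)) = InBlock⇒¬Common zw (w∈ , proj₂ (∈-edges⁻ e))
  oldInner-unreachable {U} {i} {z} zw w∈ z∈U (ra ▸ inj₁ (e , a∉U))
    with edge-gap (old-ascending i) e (proj₁ (start-common zw))
  ... | inj₂ w≤z = <⇒≱ (after-start zw) w≤z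
  ... | inj₁ z≤a with m≤n⇒m<n∨m≡n z≤a
  ...   | inj₂ z≡a = a∉U (subst (λ x → (x , i) ∈ U) (rank-injective z≡a) z∈U)
  ...   | inj₁ z≺a = oldInner-unreachable
          (InBlock-shrink zw (inj₁ a∈) z≺a (edge-ascends (i , inj₁ e))) a∈ z∈U ra
    where a∈ = proj₁ (∈-edges⁻ e)

  common-on-transient : ∀ {U i c p} → Walk (Active G U i) s t p → Common i c → c ∈ p
  common-on-transient {U} {i} {c} {p} T cc@(c∈ , _) =
    walk-hits rank-injective Active-ascends T (s-least (inj₁ c∈)) (t-greatest (inj₁ c∈)) noJump
    where
    noJump : ∀ {u v} → u ∈ p → Active G U i u v → u ≺ c → rank v ≤ rank c
    noJump _ a u≺c with Active-gap cc a
    ... | inj₁ c≤u = ⊥-elim (<⇒≱ u≺c c≤u)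
    ... | inj₂ v≤c = v≤c

  -- after z is updated, a transient walk leaves z along update edges and cannot enter the
  -- old-only part of the block, so it reaches w and must leave it along an active update edge
  newInner-updated : ∀ {U i z w p} → Walk (Active G U i) s t p →
    InBlock i z w → w ∈ upd i → (z , i) ∈ U → (w , i) ∈ U
  newInner-updated {U} {i} {z} {w} T zw w∈ z∈U
    with walk-suffix T (common-on-transient T (start-common zw))
  ... | q , Tq , q⊆ with walk-leaves Tq (walk-hits rank-injective Active-ascends Tq
                           (<⇒≤ (after-start zw)) (t-greatest (member zw)) noJump)
    where
    noJump : ∀ {u v} → u ∈ q → Active G U i u v → u ≺ w → rank v ≤ rank w
    noJump _ (inj₂ (e , _)) u≺w with edge-gap (upd-ascending i) e w∈
    ... | inj₁ w≤u = ⊥-elim (<⇒≱ u≺w w≤u)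
    ... | inj₂ v≤w = v≤w
    noJump u∈ (inj₁ (e , u∉U)) u≺w
      with m≤n⇒m<n∨m≡n (source-least (mapWalk (Active-ascends ∘ edge⇒R Tq) Tq) u∈)
    ... | inj₂ z≡u = ⊥-elim (u∉U (subst (λ x → (x , i) ∈ U) (rank-injective z≡u) z∈U))
    ... | inj₁ z≺u = ⊥-elim (oldInner-unreachable
          (InBlock-shrink zw (inj₁ u∈old) z≺u u≺w) u∈old z∈U (reachable-on-walk source T (q⊆ u∈)))
      where u∈old = proj₁ (∈-edges⁻ e)
  ... | inj₁ w≡t = ⊥-elim (InBlock⇒¬Common zw (subst (Common i) (sym w≡t) (t-common i)))
  ... | inj₂ (_ , inj₁ (e , _)) = ⊥-elim (InBlock⇒¬Common zw (proj₁ (∈-edges⁻ e) , w∈))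
  ... | inj₂ (_ , inj₂ (_ , w∈U)) = w∈U

  oldInner-notUpdated : ∀ {U i z w p} → Walk (Active G U i) s t p →
    InBlock i z w → w ∈ old i → (z , i) ∉ U → (w , i) ∉ U
  oldInner-notUpdated {U} {i} {z} {w} T zw w∈ z∉U
    with walk-suffix T (common-on-transient T (start-common zw))
  ... | q , Tq , q⊆ with walk-leaves Tq (walk-hits rank-injective Active-ascends Tq
                           (<⇒≤ (after-start zw)) (t-greatest (member zw)) noJump)
    where
    noJump : ∀ {u v} → u ∈ q → Active G U i u v → u ≺ w → rank v ≤ rank w
    noJump _ (inj₁ (e , _)) u≺w with edge-gap (old-ascending i) e w∈
    ... | inj₁ w≤u = ⊥-elim (<⇒≱ u≺w w≤u)
    ... | inj₂ v≤w = v≤w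
    noJump u∈ (inj₂ (e , u∈U)) u≺w
      with m≤n⇒m<n∨m≡n (source-least (mapWalk (Active-ascends ∘ edge⇒R Tq) Tq) u∈)
    ... | inj₂ z≡u = ⊥-elim (z∉U (subst (λ x → (x , i) ∈ U) (sym (rank-injective z≡u)) u∈U))
    ... | inj₁ z≺u = ⊥-elim (newInner-unreachable
          (InBlock-shrink zw (inj₂ u∈upd) z≺u u≺w) u∈upd z∉U (reachable-on-walk source T (q⊆ u∈)))
      where u∈upd = proj₁ (∈-edges⁻ e)
  ... | inj₁ w≡t = ⊥-elim (InBlock⇒¬Common zw (subst (Common i) (sym w≡t) (t-common i)))
  ... | inj₂ (_ , inj₂ (e , _)) = ⊥-elim (InBlock⇒¬Common zw (w∈ , proj₁ (∈-edges⁻ e)))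
  ... | inj₂ (_ , inj₁ (_ , w∉U)) = w∉U

  -- An inner vertex off the flow chosen at its block start is unreachable, so U′ only has to
  -- copy U at common vertices and at the inner vertices that can be reached.
  record Compatible (U U′ : List (Update G)) : Set where
    field
      common-agree : ∀ {i w} → Common i w → (w , i) ∈ U ⇔ (w , i) ∈ U′
      new-follows  : ∀ {i z w} → InBlock i z w → (z , i) ∈ U → w ∉ old i → (w , i) ∈ U′
      old-follows  : ∀ {i z w} → InBlock i z w → (z , i) ∉ U → w ∉ upd i → (w , i) ∉ U′

  open Compatible

  Active-resp : ∀ {U U′ i x y} → ((x , i) ∈ U → (x , i) ∈ U′) → ((x , i) ∈ U′ → (x , i) ∈ U) →
    Active G U i x y → Active G U′ i x y
  Active-resp _  from (inj₁ (e , x∉U)) = inj₁ (e , x∉U ∘ from)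
  Active-resp to _    (inj₂ (e , x∈U)) = inj₂ (e , to x∈U)

  Active-transfer : ∀ {U U′ i x y} → Compatible U U′ →
    Reachable (Active G U i) s x → Active G U i x y → Active G U′ i x y
  Active-transfer {U} {i = i} {x} c rx a with common? i x
  ... | yes cx = Active-resp (Equivalence.to (common-agree c cx)) (Equivalence.from (common-agree c cx)) a
  ... | no ¬cx with block-start (Active-source a) ¬cx
  ...   | z , zx with a | (z , i) ∈ᵘ? U
  ...     | inj₁ (e , _) | yes z∈U = ⊥-elim (oldInner-unreachable zx (proj₁ (∈-edges⁻ e)) z∈U rx)
  ...     | inj₁ (e , _) | no z∉U  = inj₁ (e , old-follows c zx z∉U (¬cx ∘ (proj₁ (∈-edges⁻ e) ,_)))
  ...     | inj₂ (e , _) | yes z∈U = inj₂ (e , new-follows c zx z∈U (¬cx ∘ (_, proj₁ (∈-edges⁻ e))))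
  ...     | inj₂ (e , _) | no z∉U  = ⊥-elim (newInner-unreachable zx (proj₁ (∈-edges⁻ e)) z∉U rx)

  Active-transfer⁻ : ∀ {U U′ i x y p} → Walk (Active G U i) s t p → Compatible U U′ →
    Reachable (Active G U′ i) s x → Active G U′ i x y → Active G U i x y
  Active-transfer⁻ {U} {i = i} {x} T c rx a with common? i x
  ... | yes cx = Active-resp (Equivalence.from (common-agree c cx)) (Equivalence.to (common-agree c cx)) a
  ... | no ¬cx with block-start (Active-source a) ¬cx
  ...   | z , zx with a | (z , i) ∈ᵘ? U
  ...     | inj₁ (e , _) | yes z∈U = ⊥-elim (oldInner-unreachable zx (proj₁ (∈-edges⁻ e))
                                       (Equivalence.to (common-agree c (start-common zx)) z∈U) rx)
  ...     | inj₁ (e , _) | no z∉U  = inj₁ (e , oldInner-notUpdated T zx (proj₁ (∈-edges⁻ e)) z∉U)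
  ...     | inj₂ (e , _) | yes z∈U = inj₂ (e , newInner-updated T zx (proj₁ (∈-edges⁻ e)) z∈U)
  ...     | inj₂ (e , _) | no z∉U  = ⊥-elim (newInner-unreachable zx (proj₁ (∈-edges⁻ e))
                                       (z∉U ∘ Equivalence.from (common-agree c (start-common zx))) rx)

  GoodState-transfer : ∀ {U U′} → GoodState G U → Compatible U U′ → GoodState G U′
  GoodState-transfer (T , transient , unique , valid) c =
      T
    , (λ i → mapWalk-reachable (Active-transfer c) source (proj₁ (transient i)) , proj₂ (transient i))
    , (λ i p (walk , distinct) →
         unique i p (mapWalk-reachable (Active-transfer⁻ (proj₁ (transient i)) c) source walk , distinct))
    , valid

  -- the updates not inner to a block; each heads its own group in the regrouped sequence
  Leads : Fin k → Fin n → Set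
  Leads i v = Common i v ⊎ ¬ Vertex i v

  leads? : ∀ i v → Dec (Leads i v)
  leads? i v = common? i v ⊎-dec ¬? (vertex? i v)

  data Owns : Update G → Update G → Set where
    self  : ∀ {i v} → Leads i v → Owns (v , i) (v , i)
    inner : ∀ {i z w} → InBlock i z w → Owns (z , i) (w , i)

  Owns-functional : ∀ {x x′ y} → Owns x y → Owns x′ y → x ≡ x′
  Owns-functional (self _)   (self _)    = refl
  Owns-functional (self l)   (inner zw)  = ⊥-elim (Leads-¬InBlock l zw)
    where
    Leads-¬InBlock : ∀ {i z w} → Leads i w → ¬ InBlock i z w
    Leads-¬InBlock (inj₁ cw) zw = InBlock⇒¬Common zw cw
    Leads-¬InBlock (inj₂ ¬vw) zw = ¬vw (member zw)
  Owns-functional (inner zw) (self l)    = sym (Owns-functional (self l) (inner zw))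
  Owns-functional (inner zw) (inner z′w) = cong (_, _) (InBlock-start-unique zw z′w)

  Owns-total : ∀ y → Σ (Update G) λ x → Owns x y
  Owns-total (w , i) with leads? i w
  ... | yes l = (w , i) , self l
  ... | no ¬l with vertex? i w
  ...   | no ¬vw = ⊥-elim (¬l (inj₂ ¬vw))
  ...   | yes vw = (proj₁ z , i) , inner (proj₂ z)
    where z = block-start vw (¬l ∘ inj₁)

  innerOn? : ∀ (F : Fin k → List (Fin n)) i z w → Dec (InBlock i z w × w ∈ F i)
  innerOn? F i z w = inBlock? i z w ×-dec w ∈? F i

  innersOn : (Fin k → List (Fin n)) → Update G → List (Update G)
  innersOn F (z , i) = map (_, i) (filter (innerOn? F i z) (allFin n))

  ∈-innersOn⁺ : ∀ F {i z w} → InBlock i z w → w ∈ F i → (w , i) ∈ innersOn F (z , i)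
  ∈-innersOn⁺ F {i} {z} {w} zw w∈ =
    ∈-map⁺ (_, i) (∈-filter⁺ (innerOn? F i z) (∈-allFin w) (zw , w∈))

  ∈-innersOn⁻ : ∀ F {i j z w} → (w , j) ∈ innersOn F (z , i) → j ≡ i × InBlock i z w × w ∈ F i
  ∈-innersOn⁻ F {i} {z = z} w∈ with ∈-map⁻ (_, i) w∈
  ... | _ , w∈′ , refl = refl , proj₂ (∈-filter⁻ (innerOn? F i z) {xs = allFin n} w∈′)

  innersOn-unique : ∀ F x → Unique (innersOn F x)
  innersOn-unique F (z , i) = Unique.map⁺ (cong proj₁)
    (Unique.filter⁺ (innerOn? F i z) (Unique.allFin⁺ n))

  ∉-innersOn : ∀ F {x} → x ∉ innersOn F x
  ∉-innersOn F x∈ = <-irrefl refl (after-start (proj₁ (proj₂ (∈-innersOn⁻ F x∈))))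

  -- update-only inner vertices come first: before the leader they are unreachable, after it all resolved
  group : Update G → List (Update G)
  group (v , i) with leads? i v
  ... | yes _ = innersOn upd (v , i) ++ (v , i) ∷ innersOn old (v , i)
  ... | no  _ = []

  ∈-group⁻ : ∀ {x y} → y ∈ group x → Owns x y
  ∈-group⁻ {v , i} y∈ with leads? i v
  ∈-group⁻ {v , i} y∈ | yes l with ∈-++⁻ (innersOn upd (v , i)) y∈
  ... | inj₁ y∈upd with ∈-innersOn⁻ upd y∈upd
  ...   | refl , vw , _ = inner vw
  ∈-group⁻ {v , i} y∈ | yes l | inj₂ (here refl) = self l
  ∈-group⁻ {v , i} y∈ | yes l | inj₂ (there y∈old) with ∈-innersOn⁻ old y∈old
  ...   | refl , vw , _ = inner vw

  ∈-group⁺ : ∀ {x y} → Owns x y → y ∈ group x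
  ∈-group⁺ {v , i} (self l) with leads? i v
  ... | yes _ = ∈-++⁺ʳ (innersOn upd (v , i)) (here refl)
  ... | no ¬l = ⊥-elim (¬l l)
  ∈-group⁺ {z , i} (inner zw) with leads? i z | member zw
  ... | no ¬l | _        = ⊥-elim (¬l (inj₁ (start-common zw)))
  ... | yes _ | inj₁ w∈ = ∈-++⁺ʳ (innersOn upd (z , i)) (there (∈-innersOn⁺ old zw w∈))
  ... | yes _ | inj₂ w∈ = ∈-++⁺ˡ (∈-innersOn⁺ upd zw w∈)

  group-unique : ∀ x → Unique (group x)
  group-unique (v , i) with leads? i v
  ... | no  _ = []
  ... | yes _ = Unique.++⁺ (innersOn-unique upd (v , i))
                  (All.tabulate (λ y∈ v≡y → ∉-innersOn old (subst (_∈ _) (sym v≡y) y∈)) ∷ innersOn-unique old (v , i))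
                  disjoint
    where
    disjoint : ∀ {y} → ¬ (y ∈ innersOn upd (v , i) × y ∈ (v , i) ∷ innersOn old (v , i))
    disjoint (y∈ , here refl) = ∉-innersOn upd y∈
    disjoint (y∈upd , there y∈old) with ∈-innersOn⁻ upd y∈upd | ∈-innersOn⁻ old y∈old
    ... | refl , vw , w∈upd | _ , _ , w∈old = InBlock⇒¬Common vw (w∈old , w∈upd)

  regroup : List (Update G) → List (Update G)
  regroup = concatMap group

  ∈-regroup⁺ : ∀ {D x y} → x ∈ D → Owns x y → y ∈ regroup D
  ∈-regroup⁺ {x ∷ D} (here refl) xy = ∈-++⁺ˡ (∈-group⁺ xy)
  ∈-regroup⁺ {u ∷ D} (there x∈)  xy = ∈-++⁺ʳ (group u) (∈-regroup⁺ x∈ xy)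

  ∈-regroup⁻ : ∀ D {x y} → y ∈ regroup D → Owns x y → x ∈ D
  ∈-regroup⁻ (u ∷ D) y∈ xy with ∈-++⁻ (group u) y∈
  ... | inj₁ y∈u = here (Owns-functional xy (∈-group⁻ y∈u))
  ... | inj₂ y∈D = there (∈-regroup⁻ D y∈D xy)

  regroup-unique : ∀ {D} → Unique D → Unique (regroup D)
  regroup-unique {[]}    []          = []
  regroup-unique {u ∷ D} (u∉ ∷ uniq) = Unique.++⁺ (group-unique u) (regroup-unique uniq)
    λ (y∈u , y∈D) → All.lookup u∉ (∈-regroup⁻ D y∈D (∈-group⁻ y∈u)) refl

  regroup-pending-compatible : ∀ {D E} → (∀ {w j} → (w , j) ∈ E → w ∉ old j × w ∈ upd j) →
    Compatible D (regroup D ++ E)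
  regroup-pending-compatible {D} {E} E-updOnly = record
    { common-agree = λ cw → mk⇔ (λ w∈D → ∈-++⁺ˡ (∈-regroup⁺ w∈D (self (inj₁ cw)))) (from cw)
    ; new-follows  = λ zw z∈D _ → ∈-++⁺ˡ (∈-regroup⁺ z∈D (inner zw))
    ; old-follows  = old-follows′ }
    where
    from : ∀ {i w} → Common i w → (w , i) ∈ regroup D ++ E → (w , i) ∈ D
    from cw w∈ with ∈-++⁻ (regroup D) w∈
    ... | inj₁ w∈D = ∈-regroup⁻ D w∈D (self (inj₁ cw))
    ... | inj₂ w∈E = ⊥-elim (proj₁ (E-updOnly w∈E) (proj₁ cw))
    old-follows′ : ∀ {i z w} → InBlock i z w → (z , i) ∉ D → w ∉ upd i → (w , i) ∉ regroup D ++ E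
    old-follows′ zw z∉D w∉upd w∈ with ∈-++⁻ (regroup D) w∈
    ... | inj₁ w∈D = z∉D (∈-regroup⁻ D w∈D (inner zw))
    ... | inj₂ w∈E = w∉upd (proj₂ (E-updOnly w∈E))

  regroup-started-compatible : ∀ {D P x} → x ∈ P → (∀ {y} → y ∈ P → Owns x y) →
    (∀ {y} → y ∈ innersOn upd x → y ∈ P) → Compatible (D ++ [ x ]) (regroup D ++ P)
  regroup-started-compatible {D} {P} {x} x∈P P-owned updInners⊆P = record
    { common-agree = λ cw → mk⇔ (to cw) (from cw)
    ; new-follows  = new-follows′
    ; old-follows  = old-follows′ }
    where
    to : ∀ {i w} → Common i w → (w , i) ∈ D ++ [ x ] → (w , i) ∈ regroup D ++ P
    to cw w∈ with ∈-++⁻ D w∈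
    ... | inj₁ w∈D        = ∈-++⁺ˡ (∈-regroup⁺ w∈D (self (inj₁ cw)))
    ... | inj₂ (here refl) = ∈-++⁺ʳ (regroup D) x∈P
    from : ∀ {i w} → Common i w → (w , i) ∈ regroup D ++ P → (w , i) ∈ D ++ [ x ]
    from cw w∈ with ∈-++⁻ (regroup D) w∈
    ... | inj₁ w∈D = ∈-++⁺ˡ (∈-regroup⁻ D w∈D (self (inj₁ cw)))
    ... | inj₂ w∈P = ∈-++⁺ʳ D (here (Owns-functional (self (inj₁ cw)) (P-owned w∈P)))
    new-follows′ : ∀ {i z w} → InBlock i z w → (z , i) ∈ D ++ [ x ] → w ∉ old i → (w , i) ∈ regroup D ++ P
    new-follows′ zw z∈ w∉old with ∈-++⁻ D z∈ | member zw
    ... | inj₁ z∈D        | _         = ∈-++⁺ˡ (∈-regroup⁺ z∈D (inner zw))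
    ... | inj₂ (here refl) | inj₁ w∈old = ⊥-elim (w∉old w∈old)
    ... | inj₂ (here refl) | inj₂ w∈upd = ∈-++⁺ʳ (regroup D) (updInners⊆P (∈-innersOn⁺ upd zw w∈upd))
    old-follows′ : ∀ {i z w} → InBlock i z w → (z , i) ∉ D ++ [ x ] → w ∉ upd i → (w , i) ∉ regroup D ++ P
    old-follows′ zw z∉ _ w∈ with ∈-++⁻ (regroup D) w∈
    ... | inj₁ w∈D = z∉ (∈-++⁺ˡ (∈-regroup⁻ D w∈D (inner zw)))
    ... | inj₂ w∈P = z∉ (∈-++⁺ʳ D (here (Owns-functional (inner zw) (P-owned w∈P))))

  group-prefix-pending : ∀ {x r w j} → x ∉ take r (group x) → (w , j) ∈ take r (group x) →
    w ∉ old j × w ∈ upd j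
  group-prefix-pending {v , i} {r} x∉ w∈ with leads? i v
  ... | no  _ = ⊥-elim (¬Any[] (∈-take⁻ r [] w∈))
  ... | yes _ with ∈-innersOn⁻ upd (take-before-pivot r (innersOn upd (v , i)) _ x∉ w∈)
  ...   | refl , vw , w∈upd = (λ w∈old → InBlock⇒¬Common vw (w∈old , w∈upd)) , w∈upd

  group-prefix-started : ∀ {x r y} → x ∈ take r (group x) → y ∈ innersOn upd x → y ∈ take r (group x)
  group-prefix-started {v , i} {r} x∈ y∈ with leads? i v
  ... | no  _ = ⊥-elim (¬Any[] (∈-take⁻ r [] x∈))
  ... | yes _ = take-past-pivot r _ _ (∉-innersOn upd) x∈ y∈

  regroup-prefix-compatible : ∀ σ j → Σ ℕ λ m → Compatible (take m σ) (take j (regroup σ))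
  regroup-prefix-compatible σ j with take-concatMap group σ j
  ... | inj₁ whole = length σ , subst₂ Compatible (sym (take-all (length σ) σ ≤-refl))
                                  (trans (++-identityʳ (regroup σ)) (sym whole))
                                  (regroup-pending-compatible {E = []} λ ())
  ... | inj₂ (D , x , L , r , refl , prefix) with x ∈ᵘ? take r (group x)
  ...   | no x∉  = length D , subst₂ Compatible (sym (take-length-++ D)) (sym prefix)
                     (regroup-pending-compatible (group-prefix-pending x∉))
  ...   | yes x∈ = suc (length D) , subst₂ Compatible (sym (take-suc-length-++ D)) (sym prefix)
                     (regroup-started-compatible x∈ (∈-group⁻ ∘ ∈-take⁻ r (group x)) (group-prefix-started x∈))

  regroup-valid : ∀ {σ} → ValidUpdateSequence G σ → ValidUpdateSequence G (regroup σ)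
  regroup-valid {σ} ((distinct , complete) , good) =
      (regroup-unique distinct , λ y → ∈-regroup⁺ (complete (proj₁ (Owns-total y))) (proj₂ (Owns-total y)))
    , λ j → let m , compatible = regroup-prefix-compatible σ j in GoodState-transfer (good m) compatible

  regroup-owned-consecutive : ∀ {σ x} → Unique σ → x ∈ σ → Consecutive (Owns x) (regroup σ)
  regroup-owned-consecutive {σ} {x} distinct x∈σ with ∈-∃++ x∈σ
  ... | X , Y , refl with Unique-pivot⁻ X distinct
  ...   | x∉X , x∉Y = subst (Consecutive (Owns x)) (sym (concatMap-++ group X (x ∷ Y)))
          (Consecutive-++ (regroup X) (group x) (regroup Y)
            (All.tabulate (λ y∈ xy → x∉X (∈-regroup⁻ X y∈ xy)))
            (All.tabulate ∈-group⁻)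
            (All.tabulate (λ y∈ xy → x∉Y (∈-regroup⁻ Y y∈ xy))))

  Owns⇔BlockUpdate : ∀ {i z z′} → IsBlock G rank i z z′ →
    ∀ {y} → Owns (z , i) y ⇔ BlockUpdate G rank i z z′ y
  Owns⇔BlockUpdate {i} {z} {z′} (cz , cz′ , z≺z′ , nothing-between) = mk⇔ to from
    where
    to : ∀ {y} → Owns (z , i) y → BlockUpdate G rank i z z′ y
    to (self _)   = refl , inj₁ (proj₁ cz) , ≤-refl , z≺z′
    to (inner zw) = refl , member zw , <⇒≤ (after-start zw) , before-next zw z′ cz′ z≺z′
    from : ∀ {y} → BlockUpdate G rank i z z′ y → Owns (z , i) y
    from {w , _} (refl , vw , z≤w , w≺z′) with m≤n⇒m<n∨m≡n z≤w
    ... | inj₂ z≡w = subst (λ v → Owns (z , i) (v , i)) (rank-injective z≡w) (self (inj₁ cz))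
    ... | inj₁ z≺w = inner record
      { start-common = cz ; member = vw ; after-start = z≺w ; before-next = next }
      where
      next : ∀ c → Common i c → z ≺ c → w ≺ c
      next c cc z≺c with rank w <? rank c
      ... | yes w≺c = w≺c
      ... | no  w⊀c = ⊥-elim (nothing-between c cc z≺c (≤-<-trans (≮⇒≥ w⊀c) w≺z′))

  regroup-blocks-consecutive : ∀ {σ i z z′} → ValidUpdateSequence G σ → IsBlock G rank i z z′ →
    Consecutive (BlockUpdate G rank i z z′) (regroup σ)
  regroup-blocks-consecutive {σ} {i} {z} ((distinct , complete) , _) block =
    Consecutive-resp {σ = regroup σ} (λ {y} → Owns⇔BlockUpdate block {y})
      (regroup-owned-consecutive distinct (complete (z , i)))

lemma3 : ∀ {n k : ℕ} (G : UFN n k) → IsUpdateFlowNetwork G → Acyclic G →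
    (rank : Fin n → ℕ) → IsTopOrder G rank →
    (σ : List (Update G)) → ValidUpdateSequence G σ →
    Σ (List (Update G)) λ σ' → ValidUpdateSequence G σ' ×
    (∀ i z z' → IsBlock G rank i z z' → Consecutive (BlockUpdate G rank i z z') σ')
lemma3 G ufn _ rank top σ valid = regroup σ , regroup-valid valid , λ i z z′ → regroup-blocks-consecutive valid
  where open Network G ufn rank top
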